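{- Let $k$ be an infinite field with $\mathrm{char}(k)\neq 2,3$ and $V_2$ a $2$-dimensional $k$-vector space with basis $\{e_1,e_2\}$. Let $\mathcal{P}=(\mathcal{H}_1,\mathcal{H}_2)$ be a homogeneous $2$-partition of $K_6^3$. If $\mathcal{P}$ satisfies one of the following conditions, then $\widehat{\omega_{\mathcal{P}}}=0$ in $\Lambda^{S^3}_{V_2}[6]$: (i) there exist four distinct $x,y,z,t\in\{1,\dots,6\}$ and $i\in\{1,2\}$ such that $\{x,y,z\},\{x,y,t\},\{x,z,t\},\{y,z,t\}\in\mathcal{H}_i$; (ii) there exist five distinct $x,y,z,t,u\in\{1,\dots,6\}$ and $i\in\{1,2\}$ such that $\{x,y,z\},\{x,y,t\},\{x,z,t\},\{y,z,u\},\{y,t,u\},\{z,t,u\}\in\mathcal{H}_i$; (iii) there exist six distinct $x,y,z,t,u,v\in\{1,\dots,6\}$ and $i\in\{1,2\}$ such that $\{x,y,u\},\{x,y,v\},\{y,z,u\},\{x,z,u\},\{x,t,v\},\{y,t,v\},\{y,z,t\},\{x,z,t\}\in\mathcal{H}_i$; (iv) there exist six distinct $x,y,z,t,u,v\in\{1,\dots,6\}$ and $i\in\{1,2\}$ such that $\{x,y,z\},\{x,y,t\},\{x,z,t\},\{x,y,u\},\{y,t,u\},\{x,y,v\},\{x,u,v\},\{y,z,v\},\{z,t,v\},\{t,u,v\}\in\mathcal{H}_i$.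
   Context: For a $k$-vector space $V$ and $n\ge 0$, $\mathcal{T}^{S^3}_V[n]=V^{\otimes\binom{n}{3}}$, with tensor factors indexed by the triples $(i,j,k)$, $1\le i<j<k\le n$; simple tensors are written $\otimes_{1\le i<j<k\le n}(v_{i,j,k})$. $\mathcal{E}^{S^3}_V[n]$ is the subspace spanned by all simple tensors for which there exist $1\le x<y<z<t\le n$ with $v_{x,y,z}=v_{x,y,t}=v_{x,z,t}=v_{y,z,t}$; $\Lambda^{S^3}_V[n]=\mathcal{T}^{S^3}_V[n]/\mathcal{E}^{S^3}_V[n]$ and $\hat\omega$ is the image of $\omega$. $K_6^3$ is the complete $3$-uniform hypergraph on $\{1,\dots,6\}$ (hyperedges: all $20$ three-element subsets). A homogeneous $2$-partition of $K_6^3$ is an ordered pair $(\mathcal{H}_1,\mathcal{H}_2)$ of disjoint sets of hyperedges with union all $20$ hyperedges and $|\mathcal{H}_1|=|\mathcal{H}_2|=10$. Its associated tensor is $\omega_{\mathcal{P}}=\otimes_{1\le i<j<k\le 6}(v_{i,j,k})\in V_2^{\otimes 20}$ with $v_{i,j,k}=e_1$ if $\{i,j,k\}\in\mathcal{H}_1$ and $v_{i,j,k}=e_2$ otherwise. -}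

module Defs where

open import Level using (Level; _⊔_)
open import Algebra.Bundles using (CommutativeRing)
open import Data.Empty using (⊥)
open import Data.Nat using (ℕ)
open import Data.Bool using (Bool; if_then_else_) renaming (_≟_ to _≟B_)
open import Data.Fin using (Fin; zero; suc; _<_; _<?_)
open import Data.Fin.Subset using (Subset; ⁅_⁆; _∪_; ∣_∣)
open import Data.Vec.Properties using (≡-dec)
open import Data.List using (List; []; _∷_; length; foldr; map; concatMap)
open import Data.List.Membership.Propositional using (_∈_)
import Data.List.Membership.DecPropositional as DecMem
open import Data.List.Relation.Unary.All using (All)
open import Data.List.Relation.Unary.Unique.Propositional using (Unique)
open import Data.Product using (Σ; ∃; _×_; _,_; proj₁; proj₂)
open import Data.Sum using (_⊎_)
open import Relation.Nullary using (¬_; does)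
open import Relation.Binary.PropositionalEquality using (_≡_)

record Field (c ℓ : Level) : Set (Level.suc (c ⊔ ℓ)) where
  field
    commutativeRing : CommutativeRing c ℓ
  open CommutativeRing commutativeRing public
  field
    0≉1     : ¬ (0# ≈ 1#)
    inverse : ∀ x → ¬ (x ≈ 0#) → ∃ λ y → x * y ≈ 1#

module _ {c ℓ : Level} (K : Field c ℓ) where
  open Field K

  IsInfinite : Set (c ⊔ ℓ)
  IsInfinite = Σ (ℕ → Carrier) λ g → ∀ m n → g m ≈ g n → m ≡ n

  CharNot2 : Set ℓ
  CharNot2 = ¬ (1# + 1# ≈ 0#)

  CharNot3 : Set ℓ
  CharNot3 = ¬ (1# + 1# + 1# ≈ 0#)

  V₂ : Set c
  V₂ = Carrier × Carrier

  e₁ e₂ : V₂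
  e₁ = 1# , 0#
  e₂ = 0# , 1#

  _≈V_ : V₂ → V₂ → Set ℓ
  (a , b) ≈V (a' , b') = (a ≈ a') × (b ≈ b')

  coord : V₂ → Fin 2 → Carrier
  coord (a , _) zero    = a
  coord (_ , b) (suc _) = b

  -- T^{S³}_{V₂}[n] = V₂^{⊗ C(n,3)}, factors indexed by triples i<j<k.
  -- It is represented in coordinates w.r.t. the tensor basis: a basis
  -- tensor is ⊗_{i<j<k} e_{f(i,j,k)} for f assigning a basis index to
  -- each triple (values of f at non-increasing triples are ignored).

  triples : (n : ℕ) → List (Fin n × Fin n × Fin n)
  triples n =
    concatMap (λ i → concatMap (λ j → concatMap (λ k →
      if does (i <? j) then (if does (j <? k) then (i , j , k) ∷ [] else [])
      else []) (Data.List.allFin n)) (Data.List.allFin n)) (Data.List.allFin n)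
    where import Data.List

  BasisIndex : ℕ → Set
  BasisIndex n = Fin n → Fin n → Fin n → Fin 2

  Tensor : ℕ → Set c
  Tensor n = BasisIndex n → Carrier

  -- families of vectors v_{i,j,k} (only i<j<k are used)
  Family : ℕ → Set c
  Family n = Fin n → Fin n → Fin n → V₂

  prod : List Carrier → Carrier
  prod = foldr _*_ 1#

  sum : List Carrier → Carrier
  sum = foldr _+_ 0#

  simple : (n : ℕ) → Family n → Tensor n
  simple n v f = prod (map (λ { (i , j , k) → coord (v i j k) (f i j k) }) (triples n))

  EGenerator : (n : ℕ) → Family n → Set ℓ
  EGenerator n v = ∃ λ x → ∃ λ y → ∃ λ z → ∃ λ t →
    (x < y) × (y < z) × (z < t) ×
    (v x y z ≈V v x y t) × (v x y t ≈V v x z t) × (v x z t ≈V v y z t)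

  InE : (n : ℕ) → Tensor n → Set (c ⊔ ℓ)
  InE n ω = Σ (List (Carrier × Family n)) λ L →
    All (λ p → EGenerator n (proj₂ p)) L ×
    (∀ f → ω f ≈ sum (map (λ p → proj₁ p * simple n (proj₂ p) f) L))

  -- ω̂ = 0 in Λ^{S³}_{V₂}[n] = T/E  iff  ω ∈ E
  IsZeroInΛ : (n : ℕ) → Tensor n → Set (c ⊔ ℓ)
  IsZeroInΛ n ω = InE n ω

-- Hypergraph side: hyperedges of K_6^3 are 3-element subsets of Fin 6.

edge : Fin 6 → Fin 6 → Fin 6 → Subset 6
edge x y z = ⁅ x ⁆ ∪ (⁅ y ⁆ ∪ ⁅ z ⁆)

record HomPartition : Set where
  field
    H₁ H₂      : List (Subset 6)
    unique₁    : Unique H₁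
    unique₂    : Unique H₂
    edges₁     : All (λ s → ∣ s ∣ ≡ 3) H₁
    edges₂     : All (λ s → ∣ s ∣ ≡ 3) H₂
    disjoint   : ∀ s → s ∈ H₁ → s ∈ H₂ → ⊥
    covering   : ∀ s → ∣ s ∣ ≡ 3 → s ∈ H₁ ⊎ s ∈ H₂
    size₁      : length H₁ ≡ 10
    size₂      : length H₂ ≡ 10

Hpart : HomPartition → Fin 2 → List (Subset 6)
Hpart P zero    = HomPartition.H₁ P
Hpart P (suc _) = HomPartition.H₂ P

open DecMem (≡-dec {n = 6} _≟B_) using (_∈?_)

ωfamily : ∀ {c ℓ} (K : Field c ℓ) → HomPartition → Family K 6
ωfamily K P i j k =
  if does (edge i j k ∈? HomPartition.H₁ P) then e₁ K else e₂ K

ω : ∀ {c ℓ} (K : Field c ℓ) → HomPartition → Tensor K 6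
ω K P = simple K 6 (ωfamily K P)

Cond-i : HomPartition → Set
Cond-i P = ∃ λ (x : Fin 6) → ∃ λ (y : Fin 6) → ∃ λ (z : Fin 6) → ∃ λ (t : Fin 6) →
  Unique (x ∷ y ∷ z ∷ t ∷ []) × ∃ λ (i : Fin 2) →
  All (_∈ Hpart P i)
    (edge x y z ∷ edge x y t ∷ edge x z t ∷ edge y z t ∷ [])

Cond-ii : HomPartition → Set
Cond-ii P = ∃ λ (x : Fin 6) → ∃ λ (y : Fin 6) → ∃ λ (z : Fin 6) → ∃ λ (t : Fin 6) → ∃ λ (u : Fin 6) →
  Unique (x ∷ y ∷ z ∷ t ∷ u ∷ []) × ∃ λ (i : Fin 2) →
  All (_∈ Hpart P i)
    (edge x y z ∷ edge x y t ∷ edge x z t ∷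
     edge y z u ∷ edge y t u ∷ edge z t u ∷ [])

Cond-iii : HomPartition → Set
Cond-iii P = ∃ λ (x : Fin 6) → ∃ λ (y : Fin 6) → ∃ λ (z : Fin 6) → ∃ λ (t : Fin 6) → ∃ λ (u : Fin 6) → ∃ λ (v : Fin 6) →
  Unique (x ∷ y ∷ z ∷ t ∷ u ∷ v ∷ []) × ∃ λ (i : Fin 2) →
  All (_∈ Hpart P i)
    (edge x y u ∷ edge x y v ∷ edge y z u ∷ edge x z u ∷
     edge x t v ∷ edge y t v ∷ edge y z t ∷ edge x z t ∷ [])

Cond-iv : HomPartition → Set
Cond-iv P = ∃ λ (x : Fin 6) → ∃ λ (y : Fin 6) → ∃ λ (z : Fin 6) → ∃ λ (t : Fin 6) → ∃ λ (u : Fin 6) → ∃ λ (v : Fin 6) →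
  Unique (x ∷ y ∷ z ∷ t ∷ u ∷ v ∷ []) × ∃ λ (i : Fin 2) →
  All (_∈ Hpart P i)
    (edge x y z ∷ edge x y t ∷ edge x z t ∷ edge x y u ∷ edge y t u ∷
     edge x y v ∷ edge x u v ∷ edge y z v ∷ edge z t v ∷ edge t u v ∷ [])

{-# OPTIONS --safe #-}

-- Fix a tetrahedron p < q < r < s and all tensor factors off its four faces.  Putting the
-- vector e₁ + t·e₂ on all four faces gives a generator of E, and expanding it yields
-- Σₘ tᵐ·Sₘ, where Sₘ is the sum of the simple tensors carrying e₂ on exactly m faces and
-- e₁ on the others.  The generators for t = 0, 1, 2, 3 together with the all-e₂ one
-- determine every Sₘ through a Vandermonde system whose inversion only divides by 12,
-- so Sₘ ∈ E as soon as char k ≠ 2, 3.  Hence, modulo E,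
-- a colouring of the faces of a tetrahedron can be exchanged for minus the sum of the other
-- colourings with the same number of e₂'s, and a monochromatic tetrahedron vanishes.
--
-- For each of the configurations (i)–(iv) a short certificate combines these moves with
-- case splits on the colour of a hyperedge; it is checked by evaluation for every
-- injective placement of the named vertices and both colours i.

module Submission where

open import Defs
open import Data.Sum using (_⊎_; inj₁; inj₂)

open import Algebra.Bundles using (CommutativeMonoid; CommutativeSemiring)
import Algebra.Properties.CommutativeSemigroup as CommutativeSemigroupProperties
import Algebra.Properties.Semiring.Mult.TCOptimised as Multiplication
import Algebra.Solver.Ring.NaturalCoefficients.Default as Solver
open import Data.Bool using (Bool; true; false; T; if_then_else_; _∧_; _∨_)
  renaming (_≟_ to _≟ᴮ_)
open import Data.Bool.Properties using (T-∧; T-∨; T-≡)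
open import Data.Empty using (⊥-elim)
open import Data.Fin using (Fin; zero; suc; toℕ; _<_; #_)
open import Data.Fin.Properties using (_≟_; _<?_; <⇒≢; <-trans; all?)
open import Data.Fin.Subset using (Subset; ⁅_⁆; _∪_)
open import Data.Bool.ListAction using (all)
open import Data.List using (List; []; _∷_; map; foldr; filter; concatMap; allFin)
open import Data.List.Properties using (filter-all; map-cong; map-cong-local)
open import Data.List.Membership.Propositional using (_∈_; _∉_)
open import Data.List.Membership.Propositional.Properties
  using (∈-filter⁺; ∈-filter⁻; ∈-allFin; ∈-map⁺; ∈-map⁻; ∈-concat⁺′)
import Data.List.Membership.DecPropositional as DecMembership
open import Data.List.Relation.Unary.All as All using (All; []; _∷_)
open import Data.List.Relation.Unary.All.Properties using (all⁺; ++⁺; map⁺)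
open import Data.List.Relation.Unary.AllPairs using ([]; _∷_)
open import Data.List.Relation.Unary.Any using (here; there)
open import Data.List.Relation.Unary.Unique.Propositional using (Unique)
import Data.List.Relation.Unary.Unique.Propositional.Properties as UniqueProperties
import Data.List.Relation.Unary.Unique.DecPropositional as UniqueDec
open import Data.Maybe using (Maybe; just; nothing; fromMaybe; maybe′; is-nothing)
open import Data.Nat using (ℕ)
open import Data.Product using (∃; _×_; _,_; proj₁; proj₂)
import Data.Product.Properties as Product
open import Data.Vec using (Vec; []; _∷_; toList; lookup)
import Data.Vec as Vec
import Data.Vec.Properties as Vec
open import Function using (_∘_)
open import Function.Bundles using (Equivalence)
open import Relation.Binary.Definitions using (DecidableEquality)
open import Relation.Binary.PropositionalEquality as ≡ using (_≡_; _≢_; refl; ≢-sym)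
open import Relation.Nullary using (¬_; yes; no; does; isYes; ¬?)
open import Relation.Nullary.Decidable using (dec-true; dec-false; toWitness; from-yes)

module ListRemoval {a} {A : Set a} (_≟ᴬ_ : DecidableEquality A) where

  remove : A → List A → List A
  remove x = filter (λ y → ¬? (y ≟ᴬ x))

  infixl 5 _∖_
  _∖_ : List A → List A → List A
  xs ∖ []       = xs
  xs ∖ (y ∷ ys) = remove y xs ∖ ys

  ∈-remove⁺ : ∀ {x y xs} → x ∈ xs → x ≢ y → x ∈ remove y xs
  ∈-remove⁺ {y = y} = ∈-filter⁺ (λ z → ¬? (z ≟ᴬ y))

  ∈-remove⁻ : ∀ {x} y xs → x ∈ remove y xs → x ∈ xs × x ≢ y
  ∈-remove⁻ y xs = ∈-filter⁻ (λ z → ¬? (z ≟ᴬ y)) {xs = xs}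

  ∈-∖⁻ : ∀ {x} xs ys → x ∈ xs ∖ ys → x ∈ xs
  ∈-∖⁻ xs []       x∈ = x∈
  ∈-∖⁻ xs (y ∷ ys) x∈ = proj₁ (∈-remove⁻ y xs (∈-∖⁻ (remove y xs) ys x∈))

  ∉-∖ : ∀ {x} xs ys → x ∈ xs ∖ ys → x ∉ ys
  ∉-∖ xs (y ∷ ys) x∈ (here refl)  = proj₂ (∈-remove⁻ y xs (∈-∖⁻ (remove y xs) ys x∈)) refl
  ∉-∖ xs (y ∷ ys) x∈ (there x∈ys) = ∉-∖ (remove y xs) ys x∈ x∈ys

  module _ {c ℓ} (M : CommutativeMonoid c ℓ) (f : A → CommutativeMonoid.Carrier M) where
    open CommutativeMonoid M
    open CommutativeSemigroupProperties commutativeSemigroup using (x∙yz≈y∙xz)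
    open import Relation.Binary.Reasoning.Setoid setoid

    foldMap : List A → Carrier
    foldMap xs = foldr _∙_ ε (map f xs)

    foldMap-remove : ∀ {x xs} → Unique xs → x ∈ xs → foldMap xs ≈ f x ∙ foldMap (remove x xs)
    foldMap-remove {x} {y ∷ xs} (y∉xs ∷ _) _ with y ≟ᴬ x
    ... | yes refl = ∙-congˡ (reflexive (≡.cong foldMap (≡.sym
          (filter-all (λ z → ¬? (z ≟ᴬ y)) (All.map (λ y≢z → y≢z ∘ ≡.sym) y∉xs)))))
    foldMap-remove {x} {y ∷ xs} (_ ∷ u) (here x≡y)   | no y≢x = ⊥-elim (y≢x (≡.sym x≡y))
    foldMap-remove {x} {y ∷ xs} (_ ∷ u) (there x∈xs) | no _ = begin
      f y ∙ foldMap xs                       ≈⟨ ∙-congˡ (foldMap-remove u x∈xs) ⟩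
      f y ∙ (f x ∙ foldMap (remove x xs))    ≈⟨ x∙yz≈y∙xz _ _ _ ⟩
      f x ∙ (f y ∙ foldMap (remove x xs))    ∎

    foldMap-∖ : ∀ {xs ys} → Unique xs → Unique ys → All (_∈ xs) ys →
                foldMap xs ≈ foldMap ys ∙ foldMap (xs ∖ ys)
    foldMap-∖ _ _ [] = sym (identityˡ _)
    foldMap-∖ {xs} {y ∷ ys} uxs (y∉ys ∷ uys) (y∈xs ∷ ys⊆xs) = begin
      foldMap xs                                         ≈⟨ foldMap-remove uxs y∈xs ⟩
      f y ∙ foldMap (remove y xs)                        ≈⟨ ∙-congˡ (foldMap-∖ uxs′ uys ys⊆xs′) ⟩
      f y ∙ (foldMap ys ∙ foldMap (remove y xs ∖ ys))    ≈⟨ sym (assoc _ _ _) ⟩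
      (f y ∙ foldMap ys) ∙ foldMap (remove y xs ∖ ys)    ∎
      where
      uxs′ : Unique (remove y xs)
      uxs′ = UniqueProperties.filter⁺ (λ z → ¬? (z ≟ᴬ y)) uxs
      ys⊆xs′ : All (_∈ remove y xs) ys
      ys⊆xs′ = All.zipWith (λ (z∈xs , y≢z) → ∈-remove⁺ z∈xs (≢-sym y≢z)) (ys⊆xs , y∉ys)

module _ {n : ℕ} where
  open DecMembership (_≟_ {n}) using (_∈?_)

  allDistinct : ∀ k → List (Fin n) → (Vec (Fin n) k → Bool) → Bool
  allDistinct ℕ.zero    used p = p []
  allDistinct (ℕ.suc k) used p =
    all (λ x → does (x ∈? used) ∨ allDistinct k (x ∷ used) (p ∘ (x ∷_))) (allFin n)

  allDistinct-sound : ∀ {k used} p (xs : Vec (Fin n) k) → T (allDistinct k used p) →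
                      Unique (toList xs) → All (_∉ used) (toList xs) → T (p xs)
  allDistinct-sound p [] holds _ _ = holds
  allDistinct-sound {ℕ.suc k} {used} p (x ∷ xs) holds (x∉xs ∷ distinct) (x∉used ∷ xs∉used) =
    allDistinct-sound (p ∘ (x ∷_)) xs holds-x distinct (All.zipWith fresh (x∉xs , xs∉used))
    where
    candidate : Fin n → Bool
    candidate y = does (y ∈? used) ∨ allDistinct k (y ∷ used) (p ∘ (y ∷_))
    holds-x : T (allDistinct k (x ∷ used) (p ∘ (x ∷_)))
    holds-x = ≡.subst (λ b → T (b ∨ allDistinct k (x ∷ used) (p ∘ (x ∷_))))
                (dec-false (x ∈? used) x∉used) (All.lookup (all⁺ candidate (allFin n) holds) (∈-allFin x))
    fresh : ∀ {y} → x ≢ y × y ∉ used → y ∉ x ∷ used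
    fresh (x≢y , _)     (here y≡x)     = x≢y (≡.sym y≡x)
    fresh (_ , y∉used)  (there y∈used) = y∉used y∈used

Triple : ℕ → Set
Triple n = Fin n × Fin n × Fin n

infix 4 _≟₃_
_≟₃_ : ∀ {n} → DecidableEquality (Triple n)
_≟₃_ = Product.≡-dec _≟_ (Product.≡-dec _≟_ _≟_)

faces : ∀ {n} (p q r s : Fin n) → List (Triple n)
faces p q r s = (p , q , r) ∷ (p , q , s) ∷ (p , r , s) ∷ (q , r , s) ∷ []

module _ {a} {A : Set a} {n : ℕ} where

  infix 4 _≗₃_
  _≗₃_ : (g h : Fin n → Fin n → Fin n → A) → Set a
  g ≗₃ h = ∀ i j k → g i j k ≡ h i j k

  infixl 6 _[_≔_]
  _[_≔_] : (Fin n → Fin n → Fin n → A) → Triple n → A → Fin n → Fin n → Fin n → A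
  (g [ τ ≔ x ]) i j k = if does ((i , j , k) ≟₃ τ) then x else g i j k

  setFaces : (p q r s : Fin n) → (Fin n → Fin n → Fin n → A) → Vec A 4 → Fin n → Fin n → Fin n → A
  setFaces p q r s g (w₁ ∷ w₂ ∷ w₃ ∷ w₄ ∷ []) =
    g [ (q , r , s) ≔ w₄ ] [ (p , r , s) ≔ w₃ ] [ (p , q , s) ≔ w₂ ] [ (p , q , r) ≔ w₁ ]

  setFaces-off : ∀ {p q r s} g ws i j k → (i , j , k) ∉ faces p q r s →
                 setFaces p q r s g ws i j k ≡ g i j k
  setFaces-off {p} {q} {r} {s} g (_ ∷ _ ∷ _ ∷ _ ∷ []) i j k off
    with (i , j , k) ≟₃ (p , q , r) | (i , j , k) ≟₃ (p , q , s)
       | (i , j , k) ≟₃ (p , r , s) | (i , j , k) ≟₃ (q , r , s)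
  ... | yes eq | _      | _      | _      = ⊥-elim (off (here eq))
  ... | no _   | yes eq | _      | _      = ⊥-elim (off (there (here eq)))
  ... | no _   | no _   | yes eq | _      = ⊥-elim (off (there (there (here eq))))
  ... | no _   | no _   | no _   | yes eq = ⊥-elim (off (there (there (there (here eq)))))
  ... | no _   | no _   | no _   | no _   = refl

  setFaces-id : ∀ {p q r s} g {w₁ w₂ w₃ w₄} →
                g p q r ≡ w₁ → g p q s ≡ w₂ → g p r s ≡ w₃ → g q r s ≡ w₄ →
                setFaces p q r s g (w₁ ∷ w₂ ∷ w₃ ∷ w₄ ∷ []) ≗₃ g
  setFaces-id {p} {q} {r} {s} g e₁ e₂ e₃ e₄ i j k
    with (i , j , k) ≟₃ (p , q , r) | (i , j , k) ≟₃ (p , q , s)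
       | (i , j , k) ≟₃ (p , r , s) | (i , j , k) ≟₃ (q , r , s)
  ... | yes refl | _        | _        | _        = ≡.sym e₁
  ... | no _     | yes refl | _        | _        = ≡.sym e₂
  ... | no _     | no _     | yes refl | _        = ≡.sym e₃
  ... | no _     | no _     | no _     | yes refl = ≡.sym e₄
  ... | no _     | no _     | no _     | no _     = refl

-- Colourings of the four faces of a tetrahedron, grouped by weight

pattern 𝟏 = zero
pattern 𝟐 = suc zero

Colours₄ : Set
Colours₄ = Vec (Fin 2) 4

infix 4 _≟ᶜ_
_≟ᶜ_ : DecidableEquality Colours₄
_≟ᶜ_ = Vec.≡-dec _≟_

weight : Colours₄ → ℕ
weight cs = Vec.sum (Vec.map toℕ cs)

weightClass : ℕ → List Colours₄
weightClass 0 = (𝟏 ∷ 𝟏 ∷ 𝟏 ∷ 𝟏 ∷ []) ∷ []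
weightClass 1 = (𝟐 ∷ 𝟏 ∷ 𝟏 ∷ 𝟏 ∷ []) ∷ (𝟏 ∷ 𝟐 ∷ 𝟏 ∷ 𝟏 ∷ []) ∷ (𝟏 ∷ 𝟏 ∷ 𝟐 ∷ 𝟏 ∷ []) ∷ (𝟏 ∷ 𝟏 ∷ 𝟏 ∷ 𝟐 ∷ []) ∷ []
weightClass 2 = (𝟐 ∷ 𝟐 ∷ 𝟏 ∷ 𝟏 ∷ []) ∷ (𝟐 ∷ 𝟏 ∷ 𝟐 ∷ 𝟏 ∷ []) ∷ (𝟐 ∷ 𝟏 ∷ 𝟏 ∷ 𝟐 ∷ []) ∷
                (𝟏 ∷ 𝟐 ∷ 𝟐 ∷ 𝟏 ∷ []) ∷ (𝟏 ∷ 𝟐 ∷ 𝟏 ∷ 𝟐 ∷ []) ∷ (𝟏 ∷ 𝟏 ∷ 𝟐 ∷ 𝟐 ∷ []) ∷ []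
weightClass 3 = (𝟏 ∷ 𝟐 ∷ 𝟐 ∷ 𝟐 ∷ []) ∷ (𝟐 ∷ 𝟏 ∷ 𝟐 ∷ 𝟐 ∷ []) ∷ (𝟐 ∷ 𝟐 ∷ 𝟏 ∷ 𝟐 ∷ []) ∷ (𝟐 ∷ 𝟐 ∷ 𝟐 ∷ 𝟏 ∷ []) ∷ []
weightClass 4 = (𝟐 ∷ 𝟐 ∷ 𝟐 ∷ 𝟐 ∷ []) ∷ []
weightClass _ = []

∈-weightClass : ∀ cs → cs ∈ weightClass (weight cs)
∈-weightClass (𝟏 ∷ 𝟏 ∷ 𝟏 ∷ 𝟏 ∷ []) = here refl
∈-weightClass (𝟐 ∷ 𝟏 ∷ 𝟏 ∷ 𝟏 ∷ []) = here refl
∈-weightClass (𝟏 ∷ 𝟐 ∷ 𝟏 ∷ 𝟏 ∷ []) = there (here refl)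
∈-weightClass (𝟏 ∷ 𝟏 ∷ 𝟐 ∷ 𝟏 ∷ []) = there (there (here refl))
∈-weightClass (𝟏 ∷ 𝟏 ∷ 𝟏 ∷ 𝟐 ∷ []) = there (there (there (here refl)))
∈-weightClass (𝟐 ∷ 𝟐 ∷ 𝟏 ∷ 𝟏 ∷ []) = here refl
∈-weightClass (𝟐 ∷ 𝟏 ∷ 𝟐 ∷ 𝟏 ∷ []) = there (here refl)
∈-weightClass (𝟐 ∷ 𝟏 ∷ 𝟏 ∷ 𝟐 ∷ []) = there (there (here refl))
∈-weightClass (𝟏 ∷ 𝟐 ∷ 𝟐 ∷ 𝟏 ∷ []) = there (there (there (here refl)))
∈-weightClass (𝟏 ∷ 𝟐 ∷ 𝟏 ∷ 𝟐 ∷ []) = there (there (there (there (here refl))))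
∈-weightClass (𝟏 ∷ 𝟏 ∷ 𝟐 ∷ 𝟐 ∷ []) = there (there (there (there (there (here refl)))))
∈-weightClass (𝟏 ∷ 𝟐 ∷ 𝟐 ∷ 𝟐 ∷ []) = here refl
∈-weightClass (𝟐 ∷ 𝟏 ∷ 𝟐 ∷ 𝟐 ∷ []) = there (here refl)
∈-weightClass (𝟐 ∷ 𝟐 ∷ 𝟏 ∷ 𝟐 ∷ []) = there (there (here refl))
∈-weightClass (𝟐 ∷ 𝟐 ∷ 𝟐 ∷ 𝟏 ∷ []) = there (there (there (here refl)))
∈-weightClass (𝟐 ∷ 𝟐 ∷ 𝟐 ∷ 𝟐 ∷ []) = here refl

weightClass-unique : ∀ m → Unique (weightClass m)
weightClass-unique 0 = from-yes (UniqueDec.unique? _≟ᶜ_ (weightClass 0))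
weightClass-unique 1 = from-yes (UniqueDec.unique? _≟ᶜ_ (weightClass 1))
weightClass-unique 2 = from-yes (UniqueDec.unique? _≟ᶜ_ (weightClass 2))
weightClass-unique 3 = from-yes (UniqueDec.unique? _≟ᶜ_ (weightClass 3))
weightClass-unique 4 = from-yes (UniqueDec.unique? _≟ᶜ_ (weightClass 4))
weightClass-unique (ℕ.suc (ℕ.suc (ℕ.suc (ℕ.suc (ℕ.suc _))))) = []

-- Polarisation identities in a commutative semiring

-- Stated over bare operations so that the same definitions also build the ring-solver syntax below.
module Polynomials {a} {A : Set a} (_+_ _*_ : A → A → A) (0# 1# : A) where

  monomial : (Fin 4 → Fin 2 → A) → Colours₄ → A
  monomial u (x₁ ∷ x₂ ∷ x₃ ∷ x₄ ∷ []) = u (# 0) x₁ * (u (# 1) x₂ * (u (# 2) x₃ * (u (# 3) x₄ * 1#)))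

  elementary : (Fin 4 → Fin 2 → A) → A → ℕ → A
  elementary u r m = foldr _+_ 0# (map (λ cs → monomial u cs * r) (weightClass m))

  polarised : (Fin 4 → Fin 2 → A) → A → A → A
  polarised u r t = (affine (# 0) * (affine (# 1) * (affine (# 2) * (affine (# 3) * 1#))))  * r
    where
    affine : Fin 4 → A
    affine i = u i 𝟏 + (t * u i 𝟐)

  horner : A → (ℕ → A) → A
  horner t s = s 0 + (t * (s 1 + (t * (s 2 + (t * (s 3 + (t * s 4)))))))

module _ {c ℓ} (R : CommutativeSemiring c ℓ) where
  open CommutativeSemiring R renaming (refl to ≈-refl)
  open Solver R using (solve; _:=_; _:+_; _:*_; con; Polynomial)
  open Multiplication semiring using () renaming (_×_ to _×ₙ_)
  open Polynomials _+_ _*_ 0# 1#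
  private
    module Syntax {n} = Polynomials {A = Polynomial n} _:+_ _:*_ (con 0) (con 1)

    table : ∀ {n} → Vec (Polynomial n) 4 → Vec (Polynomial n) 4 → Fin 4 → Fin 2 → Polynomial n
    table as bs i 𝟏 = lookup as i
    table as bs i 𝟐 = lookup bs i

  polarised-expansion : ∀ u r t → polarised u r t ≈ horner t (elementary u r)
  polarised-expansion u r t = solve 10
    (λ a₁ a₂ a₃ a₄ b₁ b₂ b₃ b₄ r t →
      let u = table (a₁ ∷ a₂ ∷ a₃ ∷ a₄ ∷ []) (b₁ ∷ b₂ ∷ b₃ ∷ b₄ ∷ [])
      in Syntax.polarised u r t := Syntax.horner t (Syntax.elementary u r)) ≈-refl
    (u (# 0) 𝟏) (u (# 1) 𝟏) (u (# 2) 𝟏) (u (# 3) 𝟏) (u (# 0) 𝟐) (u (# 1) 𝟐) (u (# 2) 𝟐) (u (# 3) 𝟐) r t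

  12≈2·2·3 : 12 ×ₙ 1# ≈ (1# + 1#) * ((1# + 1#) * (1# + 1# + 1#))
  12≈2·2·3 = solve 0 (con 12 := (con 1 :+ con 1) :* ((con 1 :+ con 1) :* (con 1 :+ con 1 :+ con 1))) ≈-refl

  private
    coefficients : ∀ {n} → Vec (Polynomial n) 5 → ℕ → Polynomial n
    coefficients (x₀ ∷ _ ∷ _ ∷ _ ∷ _ ∷ []) 0 = x₀
    coefficients (_ ∷ x₁ ∷ _ ∷ _ ∷ _ ∷ []) 1 = x₁
    coefficients (_ ∷ _ ∷ x₂ ∷ _ ∷ _ ∷ []) 2 = x₂
    coefficients (_ ∷ _ ∷ _ ∷ x₃ ∷ _ ∷ []) 3 = x₃
    coefficients (_ ∷ _ ∷ _ ∷ _ ∷ x₄ ∷ []) 4 = x₄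
    coefficients _ _ = con 0

  -- The coefficients invert the Vandermonde system g l = Σₘ lᵐ sₘ (l = 1, 2, 3) up to the factor 12.
  inversion₁ : ∀ (s g : ℕ → Carrier) → (∀ l → g l ≈ horner (l ×ₙ 1#) s) →
    (12 ×ₙ 1#) * s 1 + ((18 ×ₙ 1#) * g 2 + ((22 ×ₙ 1#) * s 0 + (72 ×ₙ 1#) * s 4)) ≈
    (36 ×ₙ 1#) * g 1 + (4 ×ₙ 1#) * g 3
  inversion₁ s g g≈ = trans (+-congˡ (+-congʳ (*-congˡ (g≈ 2))))
    (trans (solve 5 (λ s₀ s₁ s₂ s₃ s₄ → let s = coefficients (s₀ ∷ s₁ ∷ s₂ ∷ s₃ ∷ s₄ ∷ []) in
          con 12 :* s 1 :+ (con 18 :* Syntax.horner (con 2) s :+ (con 22 :* s 0 :+ con 72 :* s 4)) :=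
          con 36 :* Syntax.horner (con 1) s :+ con 4 :* Syntax.horner (con 3) s) ≈-refl
        (s 0) (s 1) (s 2) (s 3) (s 4)) (sym (+-cong (*-congˡ (g≈ 1)) (*-congˡ (g≈ 3)))))

  inversion₂ : ∀ (s g : ℕ → Carrier) → (∀ l → g l ≈ horner (l ×ₙ 1#) s) →
    (12 ×ₙ 1#) * s 2 + ((30 ×ₙ 1#) * g 1 + (6 ×ₙ 1#) * g 3) ≈
    (24 ×ₙ 1#) * g 2 + ((12 ×ₙ 1#) * s 0 + (132 ×ₙ 1#) * s 4)
  inversion₂ s g g≈ = trans (+-congˡ (+-cong (*-congˡ (g≈ 1)) (*-congˡ (g≈ 3))))
    (trans (solve 5 (λ s₀ s₁ s₂ s₃ s₄ → let s = coefficients (s₀ ∷ s₁ ∷ s₂ ∷ s₃ ∷ s₄ ∷ []) in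
          con 12 :* s 2 :+ (con 30 :* Syntax.horner (con 1) s :+ con 6 :* Syntax.horner (con 3) s) :=
          con 24 :* Syntax.horner (con 2) s :+ (con 12 :* s 0 :+ con 132 :* s 4)) ≈-refl
        (s 0) (s 1) (s 2) (s 3) (s 4)) (sym (+-congʳ (*-congˡ (g≈ 2)))))

  inversion₃ : ∀ (s g : ℕ → Carrier) → (∀ l → g l ≈ horner (l ×ₙ 1#) s) →
    (12 ×ₙ 1#) * s 3 + ((6 ×ₙ 1#) * g 2 + ((2 ×ₙ 1#) * s 0 + (72 ×ₙ 1#) * s 4)) ≈
    (6 ×ₙ 1#) * g 1 + (2 ×ₙ 1#) * g 3
  inversion₃ s g g≈ = trans (+-congˡ (+-congʳ (*-congˡ (g≈ 2))))
    (trans (solve 5 (λ s₀ s₁ s₂ s₃ s₄ → let s = coefficients (s₀ ∷ s₁ ∷ s₂ ∷ s₃ ∷ s₄ ∷ []) in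
          con 12 :* s 3 :+ (con 6 :* Syntax.horner (con 2) s :+ (con 2 :* s 0 :+ con 72 :* s 4)) :=
          con 6 :* Syntax.horner (con 1) s :+ con 2 :* Syntax.horner (con 3) s) ≈-refl
        (s 0) (s 1) (s 2) (s 3) (s 4)) (sym (+-cong (*-congˡ (g≈ 1)) (*-congˡ (g≈ 3)))))

-- The subspace E is closed under linear combinations

basis : ∀ {c ℓ} (K : Field c ℓ) → Fin 2 → V₂ K
basis K 𝟏 = e₁ K
basis K 𝟐 = e₂ K

module ESpan {c ℓ} (K : Field c ℓ) where
  open Field K renaming (refl to ≈-refl)
  open Multiplication semiring using () renaming (_×_ to _×ₙ_)
  open Polynomials _+_ _*_ 0# 1#
  open import Algebra.Properties.Ring ring using (-‿distribˡ-*)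
  open import Relation.Binary.Reasoning.Setoid setoid

  x≈y+z⇒y≈x-z : ∀ {x y z} → x ≈ y + z → y ≈ x + - z
  x≈y+z⇒y≈x-z {x} {y} {z} x≈y+z = begin
    y              ≈⟨ sym (+-identityʳ y) ⟩
    y + 0#         ≈⟨ +-congˡ (sym (-‿inverseʳ z)) ⟩
    y + (z + - z)  ≈⟨ sym (+-assoc y z (- z)) ⟩
    (y + z) + - z  ≈⟨ +-congʳ (sym x≈y+z) ⟩
    x + - z        ∎

  sum-map-cong : ∀ {a} {A : Set a} {g h : A → Carrier} xs → (∀ x → g x ≈ h x) →
                 sum K (map g xs) ≈ sum K (map h xs)
  sum-map-cong []       g≈h = ≈-refl
  sum-map-cong (x ∷ xs) g≈h = +-cong (g≈h x) (sum-map-cong xs g≈h)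

  horner-cong : ∀ t {s s′ : ℕ → Carrier} → (∀ m → s m ≈ s′ m) → horner t s ≈ horner t s′
  horner-cong t s≈s′ = +-cong (s≈s′ 0) (*-congˡ (+-cong (s≈s′ 1) (*-congˡ (+-cong (s≈s′ 2)
                         (*-congˡ (+-cong (s≈s′ 3) (*-congˡ (s≈s′ 4))))))))

  *≉0 : ∀ {x y} → ¬ x ≈ 0# → ¬ y ≈ 0# → ¬ x * y ≈ 0#
  *≉0 {x} {y} x≉0 y≉0 xy≈0 with inverse x x≉0
  ... | x⁻¹ , xx⁻¹≈1 = y≉0 (begin
    y               ≈⟨ sym (*-identityˡ y) ⟩
    1# * y          ≈⟨ *-congʳ (trans (sym xx⁻¹≈1) (*-comm x x⁻¹)) ⟩
    (x⁻¹ * x) * y   ≈⟨ *-assoc x⁻¹ x y ⟩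
    x⁻¹ * (x * y)   ≈⟨ *-congˡ xy≈0 ⟩
    x⁻¹ * 0#        ≈⟨ zeroʳ x⁻¹ ⟩
    0#              ∎)

  12-invertible : CharNot2 K → CharNot3 K → ∃ λ h → h * (12 ×ₙ 1#) ≈ 1#
  12-invertible 2≉0 3≉0 with inverse (12 ×ₙ 1#) 12≉0
    where
    12≉0 : ¬ 12 ×ₙ 1# ≈ 0#
    12≉0 12≈0 = *≉0 2≉0 (*≉0 2≉0 3≉0) (trans (sym (12≈2·2·3 commutativeSemiring)) 12≈0)
  ... | h , 12h≈1 = h , trans (*-comm h _) 12h≈1

  simple-cong : ∀ {n} {v w : Family K n} → v ≗₃ w → ∀ f → simple K n v f ≡ simple K n w f
  simple-cong {n} v≗w f =
    ≡.cong (prod K) (map-cong (λ (i , j , k) → ≡.cong (λ x → coord K x (f i j k)) (v≗w i j k)) (triples K n))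

  module _ {n : ℕ} where

    combination : List (Carrier × Family K n) → Tensor K n
    combination L f = sum K (map (λ (k , v) → k * simple K n v f) L)

    InE-resp : ∀ {x y : Tensor K n} → (∀ f → x f ≈ y f) → InE K n y → InE K n x
    InE-resp x≈y (L , generators , y≈) = L , generators , λ f → trans (x≈y f) (y≈ f)

    InE-0 : InE K n (λ _ → 0#)
    InE-0 = [] , [] , λ _ → ≈-refl

    InE-generator : ∀ {v} → EGenerator K n v → InE K n (simple K n v)
    InE-generator {v} generator =
      (1# , v) ∷ [] , generator ∷ [] , λ f → sym (trans (+-identityʳ _) (*-identityˡ _))

    combination-++ : ∀ L₁ L₂ f → combination (L₁ Data.List.++ L₂) f ≈ combination L₁ f + combination L₂ f
    combination-++ []       L₂ f = sym (+-identityˡ _)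
    combination-++ (_ ∷ L₁) L₂ f = trans (+-congˡ (combination-++ L₁ L₂ f)) (sym (+-assoc _ _ _))

    InE-+ : ∀ {x y : Tensor K n} → InE K n x → InE K n y → InE K n (λ f → x f + y f)
    InE-+ (L₁ , generators₁ , x≈) (L₂ , generators₂ , y≈) =
      L₁ Data.List.++ L₂ , ++⁺ generators₁ generators₂ ,
      λ f → trans (+-cong (x≈ f) (y≈ f)) (sym (combination-++ L₁ L₂ f))

    combination-scale : ∀ k L f → combination (map (Data.Product.map₁ (k *_)) L) f ≈ k * combination L f
    combination-scale k []      f = sym (zeroʳ k)
    combination-scale k (_ ∷ L) f =
      trans (+-cong (*-assoc _ _ _) (combination-scale k L f)) (sym (distribˡ k _ _))

    InE-scale : ∀ k {x : Tensor K n} → InE K n x → InE K n (λ f → k * x f)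
    InE-scale k (L , generators , x≈) =
      map (Data.Product.map₁ (k *_)) L , map⁺ generators ,
      λ f → trans (*-congˡ (x≈ f)) (sym (combination-scale k L f))

    InE-neg : ∀ {x : Tensor K n} → InE K n x → InE K n (λ f → - x f)
    InE-neg {x} x∈E = InE-resp (λ f → trans (-‿cong (sym (*-identityˡ _))) (-‿distribˡ-* 1# (x f)))
                               (InE-scale (- 1#) x∈E)

    InE-sum : ∀ {a} {A : Set a} (t : A → Tensor K n) xs → (∀ {x} → x ∈ xs → InE K n (t x)) →
              InE K n (λ f → sum K (map (λ x → t x f) xs))
    InE-sum t []       _   = InE-0
    InE-sum t (x ∷ xs) t∈E = InE-+ (t∈E (here refl)) (InE-sum t xs (t∈E ∘ there))

    InE-cancel : ∀ {a} {A : Set a} (_≟ᴬ_ : DecidableEquality A) (t : A → Tensor K n) {x xs} →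
                 Unique xs → x ∈ xs → InE K n (λ f → sum K (map (λ y → t y f) xs)) →
                 (∀ {y} → y ∈ xs → y ≢ x → InE K n (t y)) → InE K n (t x)
    InE-cancel _≟ᴬ_ t {x} {xs} unique x∈xs total others =
      InE-resp (λ f → x≈y+z⇒y≈x-z (foldMap-remove +-commutativeMonoid (λ y → t y f) unique x∈xs))
        (InE-+ total (InE-neg (InE-sum t (remove x xs) λ y∈ → let y∈xs , y≢x = ∈-remove⁻ x xs y∈ in others y∈xs y≢x)))
      where open ListRemoval _≟ᴬ_

    InE-solve : ∀ {h k} {x N Q : Tensor K n} → h * k ≈ 1# → (∀ f → k * x f + N f ≈ Q f) →
                InE K n N → InE K n Q → InE K n x
    InE-solve {h} {k} {x} {N} {Q} hk≈1 kx+N≈Q N∈E Q∈E = InE-resp isolate (InE-scale h (InE-+ Q∈E (InE-neg N∈E)))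
      where
      isolate : ∀ f → x f ≈ h * (Q f + - N f)
      isolate f = begin
        x f              ≈⟨ sym (*-identityˡ (x f)) ⟩
        1# * x f         ≈⟨ *-congʳ (sym hk≈1) ⟩
        (h * k) * x f    ≈⟨ *-assoc h k (x f) ⟩
        h * (k * x f)    ≈⟨ *-congˡ (x≈y+z⇒y≈x-z (sym (kx+N≈Q f))) ⟩
        h * (Q f + - N f) ∎

∈-triples : ∀ {c ℓ} (K : Field c ℓ) {n} {i j k : Fin n} → i < j → j < k → (i , j , k) ∈ triples K n
∈-triples K {n} {i} {j} {k} i<j j<k =
  ∈-concatMap (∈-allFin i) (∈-concatMap (∈-allFin j) (∈-concatMap (∈-allFin k) listed))
  where
  ∈-concatMap : ∀ {A B : Set} {f : A → List B} {x xs y} → x ∈ xs → y ∈ f x → y ∈ concatMap f xs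
  ∈-concatMap {f = f} x∈xs y∈fx = ∈-concat⁺′ y∈fx (∈-map⁺ f x∈xs)
  listed : (i , j , k) ∈ (if does (i <? j) then (if does (j <? k) then (i , j , k) ∷ [] else []) else [])
  listed rewrite dec-true (i <? j) i<j | dec-true (j <? k) j<k = here refl

module Tetrahedron {c ℓ} (K : Field c ℓ) {p q r s : Fin 6} (p<q : p < q) (q<r : q < r) (r<s : r < s) where
  open Field K renaming (refl to ≈-refl)
  open Multiplication semiring using () renaming (_×_ to _×ₙ_)
  open Polynomials _+_ _*_ 0# 1#
  open ESpan K
  open ListRemoval (_≟₃_ {6})
  open import Relation.Binary.Reasoning.Setoid setoid

  private
    p≢q : p ≢ q
    p≢q = <⇒≢ p<q
    q≢r : q ≢ r
    q≢r = <⇒≢ q<r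
    r≢s : r ≢ s
    r≢s = <⇒≢ r<s

    pqs≢pqr : (p , q , s) ≢ (p , q , r)
    pqs≢pqr = r≢s ∘ ≡.sym ∘ ≡.cong (proj₂ ∘ proj₂)
    prs≢pqr : (p , r , s) ≢ (p , q , r)
    prs≢pqr = q≢r ∘ ≡.sym ∘ ≡.cong (proj₁ ∘ proj₂)
    qrs≢pqr : (q , r , s) ≢ (p , q , r)
    qrs≢pqr = p≢q ∘ ≡.sym ∘ ≡.cong proj₁
    prs≢pqs : (p , r , s) ≢ (p , q , s)
    prs≢pqs = q≢r ∘ ≡.sym ∘ ≡.cong (proj₁ ∘ proj₂)
    qrs≢pqs : (q , r , s) ≢ (p , q , s)
    qrs≢pqs = p≢q ∘ ≡.sym ∘ ≡.cong proj₁
    qrs≢prs : (q , r , s) ≢ (p , r , s)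
    qrs≢prs = p≢q ∘ ≡.sym ∘ ≡.cong proj₁

    faces-unique : Unique (faces p q r s)
    faces-unique = (≢-sym pqs≢pqr ∷ ≢-sym prs≢pqr ∷ ≢-sym qrs≢pqr ∷ [])
                 ∷ (≢-sym prs≢pqs ∷ ≢-sym qrs≢pqs ∷ []) ∷ (≢-sym qrs≢prs ∷ []) ∷ [] ∷ []

    faces⊆triples : All (_∈ triples K 6) (faces p q r s)
    faces⊆triples = ∈-triples K p<q q<r ∷ ∈-triples K p<q (<-trans q<r r<s)
                  ∷ ∈-triples K (<-trans p<q q<r) r<s ∷ ∈-triples K q<r r<s ∷ []

    triples-unique : Unique (triples K 6)
    triples-unique = from-yes (UniqueDec.unique? _≟₃_ (triples K 6))

  setFaces-faces : ∀ {a} {A : Set a} g (w₁ w₂ w₃ w₄ : A) →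
    let g′ = setFaces p q r s g (w₁ ∷ w₂ ∷ w₃ ∷ w₄ ∷ []) in
    g′ p q r ≡ w₁ × g′ p q s ≡ w₂ × g′ p r s ≡ w₃ × g′ q r s ≡ w₄
  setFaces-faces {A = A} g w₁ w₂ w₃ w₄ = at-pqr , at-pqs , at-prs , at-qrs
    where
    g′ : Fin 6 → Fin 6 → Fin 6 → A
    g′ = setFaces p q r s g (w₁ ∷ w₂ ∷ w₃ ∷ w₄ ∷ [])
    at-pqr : g′ p q r ≡ w₁
    at-pqr rewrite dec-true ((p , q , r) ≟₃ (p , q , r)) refl = refl
    at-pqs : g′ p q s ≡ w₂
    at-pqs rewrite dec-false ((p , q , s) ≟₃ (p , q , r)) pqs≢pqr
                 | dec-true ((p , q , s) ≟₃ (p , q , s)) refl = refl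
    at-prs : g′ p r s ≡ w₃
    at-prs rewrite dec-false ((p , r , s) ≟₃ (p , q , r)) prs≢pqr
                 | dec-false ((p , r , s) ≟₃ (p , q , s)) prs≢pqs
                 | dec-true ((p , r , s) ≟₃ (p , r , s)) refl = refl
    at-qrs : g′ q r s ≡ w₄
    at-qrs rewrite dec-false ((q , r , s) ≟₃ (p , q , r)) qrs≢pqr
                 | dec-false ((q , r , s) ≟₃ (p , q , s)) qrs≢pqs
                 | dec-false ((q , r , s) ≟₃ (p , r , s)) qrs≢prs
                 | dec-true ((q , r , s) ≟₃ (q , r , s)) refl = refl

  factor : Family K 6 → BasisIndex K 6 → Triple 6 → Carrier
  factor v f (i , j , k) = coord K (v i j k) (f i j k)

  rest : Family K 6 → BasisIndex K 6 → Carrier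
  rest v f = prod K (map (factor v f) (triples K 6 ∖ faces p q r s))

  faceProduct : Vec (V₂ K) 4 → BasisIndex K 6 → Carrier
  faceProduct (w₁ ∷ w₂ ∷ w₃ ∷ w₄ ∷ []) f =
    coord K w₁ (f p q r) * (coord K w₂ (f p q s) * (coord K w₃ (f p r s) * (coord K w₄ (f q r s) * 1#)))

  simple-split : ∀ v f → simple K 6 v f ≈ faceProduct (v p q r ∷ v p q s ∷ v p r s ∷ v q r s ∷ []) f * rest v f
  simple-split v f = foldMap-∖ *-commutativeMonoid (factor v f) triples-unique faces-unique faces⊆triples

  rest-setFaces : ∀ v ws f → rest (setFaces p q r s v ws) f ≡ rest v f
  rest-setFaces v ws f = ≡.cong (prod K) (map-cong-local (All.tabulate λ {τ} τ∉faces →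
    ≡.cong (λ w → coord K w (f (proj₁ τ) (proj₁ (proj₂ τ)) (proj₂ (proj₂ τ))))
           (setFaces-off v ws _ _ _ (∉-∖ (triples K 6) (faces p q r s) τ∉faces))))

  simple-setFaces : ∀ v ws f → simple K 6 (setFaces p q r s v ws) f ≈ faceProduct ws f * rest v f
  simple-setFaces v ws@(w₁ ∷ w₂ ∷ w₃ ∷ w₄ ∷ []) f with setFaces-faces v w₁ w₂ w₃ w₄
  ... | at-pqr , at-pqs , at-prs , at-qrs = trans (simple-split (setFaces p q r s v ws) f)
    (reflexive (≡.cong₂ _*_ (≡.cong (λ ws → faceProduct ws f) face-values) (rest-setFaces v ws f)))
    where
    v′ : Family K 6
    v′ = setFaces p q r s v ws
    face-values : (v′ p q r ∷ v′ p q s ∷ v′ p r s ∷ v′ q r s ∷ []) ≡ ws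
    face-values = ≡.cong₂ _∷_ at-pqr (≡.cong₂ _∷_ at-pqs (≡.cong₂ _∷_ at-prs (≡.cong₂ _∷_ at-qrs refl)))

  InE-constantFaces : ∀ v w → InE K 6 (simple K 6 (setFaces p q r s v (w ∷ w ∷ w ∷ w ∷ [])))
  InE-constantFaces v w with setFaces-faces v w w w w
  ... | at-pqr , at-pqs , at-prs , at-qrs =
    InE-generator {v = setFaces p q r s v (w ∷ w ∷ w ∷ w ∷ [])} (p , q , r , s , p<q , q<r , r<s , same at-pqr at-pqs , same at-pqs at-prs , same at-prs at-qrs)
    where
    same : ∀ {x y} → x ≡ w → y ≡ w → _≈V_ K x y
    same refl refl = ≈-refl , ≈-refl

  colouring : Family K 6 → Colours₄ → Tensor K 6
  colouring v cs = simple K 6 (setFaces p q r s v (Vec.map (basis K) cs))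

  weightSum : Family K 6 → ℕ → Tensor K 6
  weightSum v m f = sum K (map (λ cs → colouring v cs f) (weightClass m))

  faceCoordinates : BasisIndex K 6 → Fin 4 → Fin 2 → Carrier
  faceCoordinates f i x = coord K (basis K x) (lookup (f p q r ∷ f p q s ∷ f p r s ∷ f q r s ∷ []) i)

  colouring-monomial : ∀ v cs f → colouring v cs f ≈ monomial (faceCoordinates f) cs * rest v f
  colouring-monomial v (_ ∷ _ ∷ _ ∷ _ ∷ []) f = simple-setFaces v _ f

  coord-affine : ∀ t X → coord K (1# , t) X ≈ coord K (e₁ K) X + t * coord K (e₂ K) X
  coord-affine t 𝟏 = sym (trans (+-congˡ (zeroʳ t)) (+-identityʳ 1#))
  coord-affine t 𝟐 = sym (trans (+-identityˡ _) (*-identityʳ t))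

  polarisation : ∀ v t f → let w = (1# , t) in
    simple K 6 (setFaces p q r s v (w ∷ w ∷ w ∷ w ∷ [])) f ≈ horner t (λ m → weightSum v m f)
  polarisation v t f = begin
    simple K 6 (setFaces p q r s v (w ∷ w ∷ w ∷ w ∷ [])) f ≈⟨ simple-setFaces v _ f ⟩
    faceProduct (w ∷ w ∷ w ∷ w ∷ []) f * rest v f        ≈⟨ *-congʳ (*-cong (coord-affine t (f p q r)) (*-cong (coord-affine t (f p q s))
                                                             (*-cong (coord-affine t (f p r s)) (*-congʳ (coord-affine t (f q r s)))))) ⟩
    polarised (faceCoordinates f) (rest v f) t           ≈⟨ polarised-expansion commutativeSemiring (faceCoordinates f) (rest v f) t ⟩
    horner t (elementary (faceCoordinates f) (rest v f)) ≈⟨ horner-cong t (λ m → sum-map-cong (weightClass m)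
                                                             (λ cs → sym (colouring-monomial v cs f))) ⟩
    horner t (λ m → weightSum v m f)                     ∎
    where
    w : V₂ K
    w = (1# , t)

  InE-weightSum : CharNot2 K → CharNot3 K → ∀ v m → InE K 6 (weightSum v m)
  InE-weightSum 2≉0 3≉0 v = byWeight
    where
    h12≈1 : proj₁ (12-invertible 2≉0 3≉0) * (12 ×ₙ 1#) ≈ 1#
    h12≈1 = proj₂ (12-invertible 2≉0 3≉0)

    G : ℕ → Tensor K 6
    G l = let w = (1# , l ×ₙ 1#) in simple K 6 (setFaces p q r s v (w ∷ w ∷ w ∷ w ∷ []))

    G∈E : ∀ l → InE K 6 (G l)
    G∈E l = InE-constantFaces v _

    expansion : ∀ f l → G l f ≈ horner (l ×ₙ 1#) (λ m → weightSum v m f)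
    expansion f l = polarisation v _ f

    W₀∈E : InE K 6 (weightSum v 0)
    W₀∈E = InE-resp (λ f → +-identityʳ _) (InE-constantFaces v (e₁ K))

    W₄∈E : InE K 6 (weightSum v 4)
    W₄∈E = InE-resp (λ f → +-identityʳ _) (InE-constantFaces v (e₂ K))

    byWeight : ∀ m → InE K 6 (weightSum v m)
    byWeight 0 = W₀∈E
    byWeight 1 = InE-solve h12≈1 (λ f → inversion₁ commutativeSemiring (λ m → weightSum v m f) (λ l → G l f) (expansion f))
      (InE-+ (InE-scale _ (G∈E 2)) (InE-+ (InE-scale _ W₀∈E) (InE-scale _ W₄∈E)))
      (InE-+ (InE-scale _ (G∈E 1)) (InE-scale _ (G∈E 3)))
    byWeight 2 = InE-solve h12≈1 (λ f → inversion₂ commutativeSemiring (λ m → weightSum v m f) (λ l → G l f) (expansion f))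
      (InE-+ (InE-scale _ (G∈E 1)) (InE-scale _ (G∈E 3)))
      (InE-+ (InE-scale _ (G∈E 2)) (InE-+ (InE-scale _ W₀∈E) (InE-scale _ W₄∈E)))
    byWeight 3 = InE-solve h12≈1 (λ f → inversion₃ commutativeSemiring (λ m → weightSum v m f) (λ l → G l f) (expansion f))
      (InE-+ (InE-scale _ (G∈E 2)) (InE-+ (InE-scale _ W₀∈E) (InE-scale _ W₄∈E)))
      (InE-+ (InE-scale _ (G∈E 1)) (InE-scale _ (G∈E 3)))
    byWeight 4 = W₄∈E
    byWeight (ℕ.suc (ℕ.suc (ℕ.suc (ℕ.suc (ℕ.suc _))))) = InE-0

  InE-exchange : CharNot2 K → CharNot3 K → ∀ v cs →
                 (∀ {ds} → ds ∈ weightClass (weight cs) → ds ≢ cs → InE K 6 (colouring v ds)) →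
                 InE K 6 (colouring v cs)
  InE-exchange 2≉0 3≉0 v cs =
    InE-cancel _≟ᶜ_ (colouring v) (weightClass-unique (weight cs)) (∈-weightClass cs) (InE-weightSum 2≉0 3≉0 v (weight cs))

-- Partial colourings and certificates

-- `nothing` leaves a triple with the colour that the partition gives it.
PartialColouring : Set
PartialColouring = Fin 6 → Fin 6 → Fin 6 → Maybe (Fin 2)

open DecMembership (Vec.≡-dec {n = 6} _≟ᴮ_) using () renaming (_∈?_ to _∈ᴱ?_)

colourOf : HomPartition → Subset 6 → Fin 2
colourOf P e = if does (e ∈ᴱ? HomPartition.H₁ P) then 𝟏 else 𝟐

familyOf : ∀ {c ℓ} (K : Field c ℓ) → HomPartition → PartialColouring → Family K 6
familyOf K P σ i j k = basis K (fromMaybe (colourOf P (edge i j k)) (σ i j k))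

tensorOf : ∀ {c ℓ} (K : Field c ℓ) → HomPartition → PartialColouring → Tensor K 6
tensorOf K P σ = simple K 6 (familyOf K P σ)

data Certificate : Set where
  monochromatic : (x y z t : Fin 6) → Certificate
  exchange      : (x y z t : Fin 6) → Certificate → Certificate
  branch        : (x y z : Fin 6) → Certificate → Certificate
  either        : Certificate → Certificate → Certificate

sorted : Subset 6 → List (Fin 6)
sorted e = filter (λ i → lookup e i ≟ᴮ true) (allFin 6)

onTetrahedron : List (Fin 6) → (Fin 6 → Fin 6 → Fin 6 → Fin 6 → Bool) → Bool
onTetrahedron (a ∷ b ∷ c ∷ d ∷ []) holds = isYes (a <? b) ∧ (isYes (b <? c) ∧ (isYes (c <? d) ∧ holds a b c d))
onTetrahedron _                    _     = false

onTriangle : List (Fin 6) → (Fin 6 → Fin 6 → Fin 6 → Bool) → Bool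
onTriangle (a ∷ b ∷ c ∷ []) holds = holds a b c
onTriangle _                _     = false

allJust : Maybe (Fin 2) → Maybe (Fin 2) → Maybe (Fin 2) → Maybe (Fin 2) → Maybe Colours₄
allJust (just x₁) (just x₂) (just x₃) (just x₄) = just (x₁ ∷ x₂ ∷ x₃ ∷ x₄ ∷ [])
allJust _         _         _         _         = nothing

faceColours : PartialColouring → Fin 6 → Fin 6 → Fin 6 → Fin 6 → Maybe Colours₄
faceColours σ a b c d = allJust (σ a b c) (σ a b d) (σ a c d) (σ b c d)

exchangeable : (Colours₄ → Bool) → Colours₄ → Bool
exchangeable holds cs = all (λ ds → does (ds ≟ᶜ cs) ∨ holds ds) (weightClass (weight cs))

valid : Certificate → PartialColouring → Bool
-- A monochromatic colouring is alone in its weight class, so nothing remains to exchange it with.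
valid (monochromatic x y z t) σ = onTetrahedron (sorted (⁅ x ⁆ ∪ edge y z t)) λ a b c d →
  maybe′ (exchangeable λ _ → false) false (faceColours σ a b c d)
valid (exchange x y z t C) σ = onTetrahedron (sorted (⁅ x ⁆ ∪ edge y z t)) λ a b c d →
  maybe′ (exchangeable λ ds → valid C (setFaces a b c d σ (Vec.map just ds))) false (faceColours σ a b c d)
valid (branch x y z C) σ = onTriangle (sorted (edge x y z)) λ a b c →
  is-nothing (σ a b c) ∧ (valid C (σ [ (a , b , c) ≔ just 𝟏 ]) ∧ valid C (σ [ (a , b , c) ≔ just 𝟐 ]))
valid (either C D) σ = valid C σ ∨ valid D σ

onTetrahedron-sound : ∀ xs holds → T (onTetrahedron xs holds) →
  ∃ λ a → ∃ λ b → ∃ λ c → ∃ λ d → a < b × b < c × c < d × T (holds a b c d)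
onTetrahedron-sound (a ∷ b ∷ c ∷ d ∷ []) holds ok
  with Equivalence.to (T-∧ {isYes (a <? b)}) ok
... | a<b , ok′ with Equivalence.to (T-∧ {isYes (b <? c)}) ok′
... | b<c , ok″ with Equivalence.to (T-∧ {isYes (c <? d)}) ok″
... | c<d , ok‴ = a , b , c , d , toWitness {a? = a <? b} a<b , toWitness {a? = b <? c} b<c ,
                  toWitness {a? = c <? d} c<d , ok‴

onTriangle-sound : ∀ xs holds → T (onTriangle xs holds) → ∃ λ a → ∃ λ b → ∃ λ c → T (holds a b c)
onTriangle-sound (a ∷ b ∷ c ∷ []) holds ok = a , b , c , ok

allJust-sound : ∀ m₁ m₂ m₃ m₄ {x₁ x₂ x₃ x₄} → allJust m₁ m₂ m₃ m₄ ≡ just (x₁ ∷ x₂ ∷ x₃ ∷ x₄ ∷ []) →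
                m₁ ≡ just x₁ × m₂ ≡ just x₂ × m₃ ≡ just x₃ × m₄ ≡ just x₄
allJust-sound (just _) (just _) (just _) (just _) refl = refl , refl , refl , refl

exchangeable-sound : ∀ holds cs → T (exchangeable holds cs) →
                     ∀ {ds} → ds ∈ weightClass (weight cs) → ds ≢ cs → T (holds ds)
exchangeable-sound holds cs ok {ds} ds∈ ds≢cs =
  ≡.subst (λ b → T (b ∨ holds ds)) (dec-false (ds ≟ᶜ cs) ds≢cs)
    (All.lookup (all⁺ (λ ds → does (ds ≟ᶜ cs) ∨ holds ds) _ ok) ds∈)

is-nothing-sound : ∀ {A : Set} (m : Maybe A) → T (is-nothing m) → m ≡ nothing
is-nothing-sound nothing _ = refl

module _ {c ℓ} (K : Field c ℓ) (P : HomPartition) where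

  familyOf-setFaces : ∀ σ {a b c d} ds →
    familyOf K P (setFaces a b c d σ (Vec.map just ds)) ≗₃ setFaces a b c d (familyOf K P σ) (Vec.map (basis K) ds)
  familyOf-setFaces σ {a} {b} {c} {d} (_ ∷ _ ∷ _ ∷ _ ∷ []) i j k
    with (i , j , k) ≟₃ (a , b , c) | (i , j , k) ≟₃ (a , b , d)
       | (i , j , k) ≟₃ (a , c , d) | (i , j , k) ≟₃ (b , c , d)
  ... | yes _ | _     | _     | _     = refl
  ... | no _  | yes _ | _     | _     = refl
  ... | no _  | no _  | yes _ | _     = refl
  ... | no _  | no _  | no _  | yes _ = refl
  ... | no _  | no _  | no _  | no _  = refl

  familyOf-unset : ∀ σ {a b c} → σ a b c ≡ nothing →
    familyOf K P σ ≗₃ familyOf K P (σ [ (a , b , c) ≔ just (colourOf P (edge a b c)) ])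
  familyOf-unset σ {a} {b} {c} unset i j k with (i , j , k) ≟₃ (a , b , c)
  ... | yes refl rewrite unset = refl
  ... | no _ = refl

module Soundness {c ℓ} (K : Field c ℓ) (2≉0 : CharNot2 K) (3≉0 : CharNot3 K) (P : HomPartition) where
  open Field K renaming (refl to ≈-refl)
  open ESpan K

  exchange-sound : ∀ σ xs (holds : Fin 6 → Fin 6 → Fin 6 → Fin 6 → Colours₄ → Bool) →
    (∀ a b c d ds → T (holds a b c d ds) → InE K 6 (tensorOf K P (setFaces a b c d σ (Vec.map just ds)))) →
    T (onTetrahedron xs λ a b c d → maybe′ (exchangeable (holds a b c d)) false (faceColours σ a b c d)) →
    InE K 6 (tensorOf K P σ)
  exchange-sound σ xs holds sound ok with onTetrahedron-sound xs _ ok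
  ... | a , b , c , d , a<b , b<c , c<d , ok′ with faceColours σ a b c d in colours
  ... | just cs@(_ ∷ _ ∷ _ ∷ _ ∷ []) =
    InE-resp (λ f → reflexive (simple-cong coloured f))
      (InE-exchange 2≉0 3≉0 (familyOf K P σ) cs λ {ds} ds∈ ds≢cs →
        InE-resp (λ f → reflexive (≡.sym (simple-cong (familyOf-setFaces K P σ {a} {b} {c} {d} ds) f)))
          (sound a b c d _ (exchangeable-sound (holds a b c d) cs ok′ ds∈ ds≢cs)))
    where
    open Tetrahedron K a<b b<c c<d
    coloured : familyOf K P σ ≗₃ setFaces a b c d (familyOf K P σ) (Vec.map (basis K) cs)
    coloured with allJust-sound (σ a b c) (σ a b d) (σ a c d) (σ b c d) colours
    ... | abc , abd , acd , bcd = λ i j k → ≡.sym (setFaces-id (familyOf K P σ)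
          (≡.cong (basis K ∘ fromMaybe _) abc) (≡.cong (basis K ∘ fromMaybe _) abd)
          (≡.cong (basis K ∘ fromMaybe _) acd) (≡.cong (basis K ∘ fromMaybe _) bcd) i j k)

  branch-sound : ∀ σ a b c → σ a b c ≡ nothing →
    (∀ x → InE K 6 (tensorOf K P (σ [ (a , b , c) ≔ just x ]))) → InE K 6 (tensorOf K P σ)
  branch-sound σ a b c unset both =
    InE-resp (λ f → reflexive (simple-cong (familyOf-unset K P σ unset) f)) (both (colourOf P (edge a b c)))

  valid-sound : ∀ C σ → T (valid C σ) → InE K 6 (tensorOf K P σ)
  valid-sound (monochromatic x y z t) σ ok =
    exchange-sound σ (sorted (⁅ x ⁆ ∪ edge y z t)) (λ _ _ _ _ _ → false) (λ _ _ _ _ _ ()) ok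
  valid-sound (exchange x y z t C) σ ok =
    exchange-sound σ (sorted (⁅ x ⁆ ∪ edge y z t)) (λ a b c d ds → valid C (setFaces a b c d σ (Vec.map just ds)))
      (λ a b c d ds → valid-sound C (setFaces a b c d σ (Vec.map just ds))) ok
  valid-sound (branch x y z C) σ ok with onTriangle-sound (sorted (edge x y z)) _ ok
  ... | a , b , c , ok′ with Equivalence.to (T-∧ {is-nothing (σ a b c)}) ok′
  ... | unset , ok″ with Equivalence.to T-∧ ok″
  ... | valid₁ , valid₂ = branch-sound σ a b c (is-nothing-sound _ unset) λ where
    𝟏 → valid-sound C _ valid₁
    𝟐 → valid-sound C _ valid₂
  valid-sound (either C D) σ ok with Equivalence.to (T-∨ {valid C σ}) ok
  ... | inj₁ valid-C = valid-sound C σ valid-C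
  ... | inj₂ valid-D = valid-sound D σ valid-D

hyperedge : Triple 6 → Subset 6
hyperedge (x , y , z) = edge x y z

sort₃ : Triple 6 → Triple 6
sort₃ (x , y , z) = low (low x y) z , high (low x y) (low (high x y) z) , high (high x y) z
  where
  low high : Fin 6 → Fin 6 → Fin 6
  low a b = if isYes (a <? b) then a else b
  high a b = if isYes (a <? b) then b else a

hyperedge-sort₃ : ∀ τ → hyperedge (sort₃ τ) ≡ hyperedge τ
hyperedge-sort₃ (x , y , z) =
  from-yes (all? λ x → all? λ y → all? λ z → Vec.≡-dec _≟ᴮ_ (hyperedge (sort₃ (x , y , z))) (edge x y z)) x y z

open DecMembership (_≟₃_ {6}) using () renaming (_∈?_ to _∈₃?_)

-- The marked triples are an argument, not computed here, so that the exhaustive check of a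
-- configuration sorts them once per placement rather than at every lookup.
initial : Fin 2 → List (Triple 6) → PartialColouring
initial i marked a b c = if does ((a , b , c) ∈₃? marked) then just i else nothing

module _ {c ℓ} (K : Field c ℓ) (P : HomPartition) where

  ωfamily-colourOf : ∀ i j k → ωfamily K P i j k ≡ basis K (colourOf P (edge i j k))
  ωfamily-colourOf i j k with does (edge i j k ∈ᴱ? HomPartition.H₁ P)
  ... | true  = refl
  ... | false = refl

  colourOf-∈ : ∀ i {e} → e ∈ Hpart P i → colourOf P e ≡ i
  colourOf-∈ 𝟏 {e} e∈H₁ with e ∈ᴱ? HomPartition.H₁ P
  ... | yes _   = refl
  ... | no e∉H₁ = ⊥-elim (e∉H₁ e∈H₁)
  colourOf-∈ 𝟐 {e} e∈H₂ with e ∈ᴱ? HomPartition.H₁ P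
  ... | yes e∈H₁ = ⊥-elim (HomPartition.disjoint P e e∈H₁ e∈H₂)
  ... | no _     = refl

  ωfamily-initial : ∀ i ts → All (_∈ Hpart P i) (map hyperedge ts) → ωfamily K P ≗₃ familyOf K P (initial i (map sort₃ ts))
  ωfamily-initial i ts coloured a b c with (a , b , c) ∈₃? map sort₃ ts
  ... | no _       = ωfamily-colourOf a b c
  ... | yes marked with ∈-map⁻ sort₃ marked
  ...   | τ , τ∈ts , abc≡sorted-τ = ≡.trans (ωfamily-colourOf a b c) (≡.cong (basis K) (colourOf-∈ i abc∈Hᵢ))
    where
    abc∈Hᵢ : edge a b c ∈ Hpart P i
    abc∈Hᵢ = ≡.subst (_∈ Hpart P i) (≡.sym (≡.trans (≡.cong hyperedge abc≡sorted-τ) (hyperedge-sort₃ τ)))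
               (All.lookup coloured (∈-map⁺ hyperedge τ∈ts))

record Configuration (k : ℕ) : Set where
  field
    triangles   : Vec (Fin 6) k → List (Triple 6)
    certificate : Vec (Fin 6) k → Certificate

  certifies : Vec (Fin 6) k → Fin 2 → Bool
  certifies xs i = valid (certificate xs) (initial i (map sort₃ (triangles xs)))

Verified : ∀ {k} → Configuration k → Set
Verified {k} 𝒞 = allDistinct k [] (λ xs → all (Configuration.certifies 𝒞 xs) (allFin 2)) ≡ true

configuration-vanishes : ∀ {c ℓ} (K : Field c ℓ) → CharNot2 K → CharNot3 K → (P : HomPartition) →
  ∀ {k} (𝒞 : Configuration k) → Verified 𝒞 → (xs : Vec (Fin 6) k) → Unique (toList xs) → (i : Fin 2) →
  All (_∈ Hpart P i) (map hyperedge (Configuration.triangles 𝒞 xs)) → IsZeroInΛ K 6 (ω K P)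
configuration-vanishes K 2≉0 3≉0 P 𝒞 verified xs distinct i coloured =
  InE-resp (λ f → Field.reflexive K (simple-cong (ωfamily-initial K P i (triangles xs) coloured) f))
    (Soundness.valid-sound K 2≉0 3≉0 P (certificate xs) (initial i (map sort₃ (triangles xs))) certified)
  where
  open Configuration 𝒞
  open ESpan K using (InE-resp; simple-cong)
  certified : T (certifies xs i)
  certified = All.lookup (all⁺ (certifies xs) (allFin 2)
    (allDistinct-sound _ xs (Equivalence.from T-≡ verified) distinct (All.tabulate λ _ ()))) (∈-allFin i)

configuration-i : Configuration 4
configuration-i = record
  { triangles   = λ { (x ∷ y ∷ z ∷ t ∷ []) → (x , y , z) ∷ (x , y , t) ∷ (x , z , t) ∷ (y , z , t) ∷ [] }
  ; certificate = λ { (x ∷ y ∷ z ∷ t ∷ []) → monochromatic x y z t }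
  }

configuration-ii : Configuration 5
configuration-ii = record
  { triangles   = λ { (x ∷ y ∷ z ∷ t ∷ u ∷ []) →
      (x , y , z) ∷ (x , y , t) ∷ (x , z , t) ∷ (y , z , u) ∷ (y , t , u) ∷ (z , t , u) ∷ [] }
  ; certificate = λ { (x ∷ y ∷ z ∷ t ∷ u ∷ []) →
      branch y z t (either (monochromatic x y z t) (exchange x y z t (monochromatic y z t u))) }
  }

configuration-iii : Configuration 6
configuration-iii = record
  { triangles   = λ { (x ∷ y ∷ z ∷ t ∷ u ∷ v ∷ []) →
      (x , y , u) ∷ (x , y , v) ∷ (y , z , u) ∷ (x , z , u) ∷ (x , t , v) ∷ (y , t , v) ∷ (y , z , t) ∷ (x , z , t) ∷ [] }
  ; certificate = λ { (x ∷ y ∷ z ∷ t ∷ u ∷ v ∷ []) →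
      branch x y z (either (monochromatic x y z u) (exchange x y z u
        (branch x y t (either (monochromatic x y z t) (exchange x y z t (monochromatic x y t v)))))) }
  }

configuration-iv : Configuration 6
configuration-iv = record
  { triangles   = λ { (x ∷ y ∷ z ∷ t ∷ u ∷ v ∷ []) →
      (x , y , z) ∷ (x , y , t) ∷ (x , z , t) ∷ (x , y , u) ∷ (y , t , u) ∷
      (x , y , v) ∷ (x , u , v) ∷ (y , z , v) ∷ (z , t , v) ∷ (t , u , v) ∷ [] }
  ; certificate = λ { (x ∷ y ∷ z ∷ t ∷ u ∷ v ∷ []) →
      branch x z v (either (monochromatic x y z v) (exchange x y z v
        (branch x t u (either (monochromatic x y t u) (branch x t v (either (monochromatic x z t v)
          (exchange x t u v (either (monochromatic x z t v) (monochromatic x y t u))))))))) }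
  }

configuration-i-verified : Verified configuration-i
configuration-i-verified = refl

configuration-ii-verified : Verified configuration-ii
configuration-ii-verified = refl

configuration-iii-verified : Verified configuration-iii
configuration-iii-verified = refl

configuration-iv-verified : Verified configuration-iv
configuration-iv-verified = refl

lemma4p6 : ∀ {c ℓ} (K : Field c ℓ) → IsInfinite K → CharNot2 K → CharNot3 K →
    (P : HomPartition) →
    (Cond-i P ⊎ Cond-ii P ⊎ Cond-iii P ⊎ Cond-iv P) →
    IsZeroInΛ K 6 (ω K P)
lemma4p6 K _ 2≉0 3≉0 P (inj₁ (x , y , z , t , distinct , i , coloured)) =
  configuration-vanishes K 2≉0 3≉0 P configuration-i configuration-i-verified
    (x ∷ y ∷ z ∷ t ∷ []) distinct i coloured
lemma4p6 K _ 2≉0 3≉0 P (inj₂ (inj₁ (x , y , z , t , u , distinct , i , coloured))) =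
  configuration-vanishes K 2≉0 3≉0 P configuration-ii configuration-ii-verified
    (x ∷ y ∷ z ∷ t ∷ u ∷ []) distinct i coloured
lemma4p6 K _ 2≉0 3≉0 P (inj₂ (inj₂ (inj₁ (x , y , z , t , u , v , distinct , i , coloured)))) =
  configuration-vanishes K 2≉0 3≉0 P configuration-iii configuration-iii-verified
    (x ∷ y ∷ z ∷ t ∷ u ∷ v ∷ []) distinct i coloured
lemma4p6 K _ 2≉0 3≉0 P (inj₂ (inj₂ (inj₂ (x , y , z , t , u , v , distinct , i , coloured)))) =
  configuration-vanishes K 2≉0 3≉0 P configuration-iv configuration-iv-verified
    (x ∷ y ∷ z ∷ t ∷ u ∷ v ∷ []) distinct i coloured
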